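{- Let $P$ be the Fibonacci cobweb poset described in the context. For $x=\langle s,t\rangle$ and $y=\langle u,v\rangle$ in $P$ (so $t,v\in\mathbf{N}$, $1\le s\le F_t$, $1\le u\le F_v$), the Möbius function of $P$ is given by $$\mu(x,y)=\mu(\langle s,t\rangle,\langle u,v\rangle)=\delta(t,v)\,\delta(s,u)-\delta(t+1,v)+\sum_{k=2}^{\infty}\delta(t+k,v)\,(-1)^{k}\prod_{i=t+1}^{v-1}(F_i-1),$$ where $\delta$ is the Kronecker delta ($\delta(a,b)=1$ if $a=b$ and $0$ otherwise).
   Context: $(F_n)_{n\ge1}$ denotes the Fibonacci sequence, $F_1=F_2=1$, $F_{n+2}=F_{n+1}+F_n$. The Fibonacci cobweb poset $P$ has vertex set $\bigcup_{p\ge1}\Phi_p$, where the $p$-th level is $\Phi_p=\{\langle j,p\rangle : 1\le j\le F_p\}$; thus an element $\langle i,j\rangle$ is the $i$-th element of level $j$. The partial order is: for $x=\langle s,t\rangle$, $y=\langle u,v\rangle$, $x\le y$ if and only if $t<v$, or ($t=v$ and $s=u$). (Equivalently its Hasse diagram joins every element of level $p$ to every element of level $p+1$.) The Möbius function $\mu$ of this locally finite poset is the inverse of the zeta function $\zeta(x,y)=1$ if $x\le y$ and $0$ otherwise in the incidence algebra of $P$ (functions $f:P\times P\to\mathbf{R}$ with $f(x,y)=0$ unless $x\le y$, with convolution $(f*g)(x,y)=\sum_{x\le z\le y}f(x,z)g(z,y)$); equivalently $\mu(x,x)=1$, $\mu(x,y)=-\sum_{x\le z<y}\mu(x,z)$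 for $x<y$, and $\mu(x,y)=0$ unless $x\le y$. -}

module Defs where

open import Data.Nat using (ℕ; zero; suc; _≤_; _<_; _≡ᵇ_; _<ᵇ_)
open import Data.Bool using (Bool; true; false; if_then_else_; _∧_; _∨_)
open import Data.Integer using (ℤ; +_; -_) renaming (_+_ to _+ℤ_; _-_ to _-ℤ_; _*_ to _*ℤ_; _^_ to _^ℤ_)
open import Data.List using (List; map; upTo; foldr)
open import Data.Product using (_×_)
open import Data.Sum using (_⊎_)
open import Relation.Binary.PropositionalEquality using (_≡_)

-- Fibonacci numbers, F 1 = F 2 = 1 (F 0 = 0 is auxiliary, never a level)
F : ℕ → ℕ
F zero = 0
F (suc zero) = 1
F (suc (suc n)) = F (suc n) Data.Nat.+ F n

-- Elements of the cobweb poset: ⟨ s , t ⟩, the s-th element of level t,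
-- with t ≥ 1 and 1 ≤ s ≤ F t.
record Elem : Set where
  constructor ⟨_,_⟩∈_
  field
    s : ℕ
    t : ℕ
    valid : (1 ≤ t) × (1 ≤ s) × (s ≤ F t)
open Elem public

leqᵇ : ℕ → ℕ → ℕ → ℕ → Bool
leqᵇ s t u v = (t <ᵇ v) ∨ ((t ≡ᵇ v) ∧ (s ≡ᵇ u))

_≤P_ : Elem → Elem → Set
x ≤P y = (t x < t y) ⊎ ((t x ≡ t y)
           × (s x ≡ s y))

sumℤ : List ℤ → ℤ
sumℤ = foldr _+ℤ_ (+ 0)

prodℤ : List ℤ → ℤ
prodℤ = foldr _*ℤ_ (+ 1)

oneTo : ℕ → List ℕ
oneTo n = map suc (upTo n)

-- indices a .. b (empty if b < a)
range : ℕ → ℕ → List ℕ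
range a b = map (λ i → a Data.Nat.+ i) (upTo (suc b Data.Nat.∸ a))

-- Möbius function on raw coordinates, x = ⟨s,t⟩, y = ⟨u,v⟩:
--   μ(x,y) = 0 unless x ≤ y ; μ(x,x) = 1 ;
--   μ(x,y) = - Σ_{x ≤ z < y} μ(x,z)   for x < y.
-- below s t v = Σ over all z of P with level(z) ≤ v and x ≤ z of μ(x,z).
-- For y of level v+1 and x < y, {z : x ≤ z < y} = {z : x ≤ z, level z ≤ v}.
mutual
  μraw : ℕ → ℕ → ℕ → ℕ → ℤ
  μraw s t u zero = + 0
  μraw s t u (suc v) =
    if leqᵇ s t u (suc v)
    then (if (t ≡ᵇ suc v) ∧ (s ≡ᵇ u) then + 1 else - below s t v)
    else + 0

  below : ℕ → ℕ → ℕ → ℤ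
  below s t zero = + 0
  below s t (suc v) =
    below s t v +ℤ
    sumℤ (map (λ j → if leqᵇ s t j (suc v) then μraw s t j (suc v) else + 0)
              (oneTo (F (suc v))))

μ : Elem → Elem → ℤ
μ x y = μraw (s x) (t x) (s y) (t y)

δ : ℕ → ℕ → ℤ
δ a b = if a ≡ᵇ b then + 1 else + 0

-- Right-hand side of the formula:
--  δ(t,v)δ(s,u) - δ(t+1,v) + Σ_{k=2}^{∞} δ(t+k,v) (-1)^k ∏_{i=t+1}^{v-1} (F_i - 1)
-- The infinite sum is written as Σ_{k=2}^{v}: for k > v we have t+k > v, so
-- every omitted term has δ(t+k,v) = 0.
formula : ℕ → ℕ → ℕ → ℕ → ℤ
formula s t u v =
  (δ t v *ℤ δ s u) -ℤ δ (suc t) v +ℤ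
  sumℤ (map (λ k → δ (t Data.Nat.+ k) v *ℤ ((- + 1) ^ℤ k) *ℤ
                    prodℤ (map (λ i → (+ F i) -ℤ (+ 1)) (range (suc t) (v Data.Nat.∸ 1))))
            (range 2 v))

{-# OPTIONS --safe #-}
module Submission where

-- Let x lie on level t and write Σ_w for the sum of μ(x,z) over all z ≥ x of level
-- at most w.  Level t contributes only μ(x,x) = 1, so Σ_t = 1.  For every z on a level
-- w + 1 > t the interval [x, z) is all of levels ≤ w above x, hence μ(x,z) = −Σ_w, and the
-- F_{w+1} such z give Σ_{w+1} = Σ_w (1 − F_{w+1}).  Thus Σ_{t+k} = (−1)^k ∏_{i=t+1}^{t+k} (F_i − 1)
-- and μ(x,y) = −Σ_{t+k} on level t + k + 1, which is the single surviving term of the formula.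

open import Defs
open import Data.Bool using (true; false; if_then_else_)
open import Data.Integer using (ℤ; +_; -_)
  renaming (_+_ to _+ℤ_; _-_ to _-ℤ_; _*_ to _*ℤ_; _^_ to _^ℤ_)
import Data.Integer.Properties as ℤ
open import Data.Integer.Tactic.RingSolver using (solve-∀)
open import Data.List using (map; applyUpTo)
open import Data.List.Properties using (map-applyUpTo; map-cong)
open import Data.Nat using (ℕ; zero; suc; _+_; _∸_; _≤_; _<_; _≡ᵇ_; _<ᵇ_; s≤s; z≤n;
  compare; less; equal; greater)
open import Data.Nat.Properties using (_≟_; _<?_; <⇒≢; >⇒≢; <-irrefl; <-asym;
  <-trans; <-≤-trans; ≤-trans; ≤-reflexive; n<1+n; m≤m+n; m<m+n; m≤n+m;
  +-comm; +-monoʳ-≤; +-suc; +-identityʳ;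
  +-cancelˡ-≡; m+n∸m≡n; suc-injective)
open import Data.Product using (_,_)
open import Function using (id; _∘_)
open import Relation.Nullary using (¬_)
open import Relation.Nullary.Decidable using (dec-true; dec-false)
open import Relation.Binary.PropositionalEquality
  using (_≡_; _≢_; refl; sym; trans; cong; cong₂; ≢-sym; module ≡-Reasoning)
open ≡-Reasoning

≡ᵇ-refl : ∀ n → (n ≡ᵇ n) ≡ true
≡ᵇ-refl n = dec-true (n ≟ n) refl

≢⇒≡ᵇ-false : ∀ {m n} → m ≢ n → (m ≡ᵇ n) ≡ false
≢⇒≡ᵇ-false {m} {n} = dec-false (m ≟ n)

<⇒<ᵇ-true : ∀ {m n} → m < n → (m <ᵇ n) ≡ true
<⇒<ᵇ-true {m} {n} = dec-true (m <? n)

≮⇒<ᵇ-false : ∀ {m n} → ¬ m < n → (m <ᵇ n) ≡ false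
≮⇒<ᵇ-false {m} {n} = dec-false (m <? n)

δ-refl : ∀ n → δ n n ≡ + 1
δ-refl n rewrite ≡ᵇ-refl n = refl

δ-≢ : ∀ {m n} → m ≢ n → δ m n ≡ + 0
δ-≢ m≢n rewrite ≢⇒≡ᵇ-false m≢n = refl

sum-applyUpTo-const : ∀ (f : ℕ → ℤ) {c} n → (∀ i → f i ≡ c) → sumℤ (applyUpTo f n) ≡ + n *ℤ c
sum-applyUpTo-const f {c} zero f≡c = sym (ℤ.*-zeroˡ c)
sum-applyUpTo-const f {c} (suc n) f≡c = begin
  f 0 +ℤ sumℤ (applyUpTo (f ∘ suc) n)
    ≡⟨ cong₂ _+ℤ_ (f≡c 0) (sum-applyUpTo-const (f ∘ suc) n (f≡c ∘ suc)) ⟩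
  c +ℤ + n *ℤ c                        ≡⟨ sym (ℤ.suc-* (+ n) c) ⟩
  + suc n *ℤ c                         ∎

sum-applyUpTo-zero : ∀ (f : ℕ → ℤ) n → (∀ i → f i ≡ + 0) → sumℤ (applyUpTo f n) ≡ + 0
sum-applyUpTo-zero f n f≡0 = trans (sum-applyUpTo-const f n f≡0) (ℤ.*-zeroʳ (+ n))

sum-applyUpTo-single : ∀ (f : ℕ → ℤ) {d n} → d < n → (∀ i → i ≢ d → f i ≡ + 0) →
                       sumℤ (applyUpTo f n) ≡ f d
sum-applyUpTo-single f {zero} {suc n} _ f≡0 = begin
  f 0 +ℤ sumℤ (applyUpTo (f ∘ suc) n)
    ≡⟨ cong (f 0 +ℤ_) (sum-applyUpTo-zero (f ∘ suc) n (λ i → f≡0 (suc i) λ ())) ⟩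
  f 0 +ℤ + 0                           ≡⟨ ℤ.+-identityʳ (f 0) ⟩
  f 0                                  ∎
sum-applyUpTo-single f {suc d} {suc n} (s≤s d<n) f≡0 = begin
  f 0 +ℤ sumℤ (applyUpTo (f ∘ suc) n) ≡⟨ cong (_+ℤ sumℤ (applyUpTo (f ∘ suc) n)) (f≡0 0 λ ()) ⟩
  + 0 +ℤ sumℤ (applyUpTo (f ∘ suc) n) ≡⟨ ℤ.+-identityˡ _ ⟩
  sumℤ (applyUpTo (f ∘ suc) n)
    ≡⟨ sum-applyUpTo-single (f ∘ suc) d<n (λ i i≢d → f≡0 (suc i) (i≢d ∘ suc-injective)) ⟩
  f (suc d)                            ∎

prod-applyUpTo-suc : ∀ (f : ℕ → ℤ) n → prodℤ (applyUpTo f (suc n)) ≡ prodℤ (applyUpTo f n) *ℤ f n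
prod-applyUpTo-suc f zero = ℤ.*-comm (f 0) (+ 1)
prod-applyUpTo-suc f (suc n) = begin
  f 0 *ℤ prodℤ (applyUpTo (f ∘ suc) (suc n))           ≡⟨ cong (f 0 *ℤ_) (prod-applyUpTo-suc (f ∘ suc) n) ⟩
  f 0 *ℤ (prodℤ (applyUpTo (f ∘ suc) n) *ℤ f (suc n))  ≡⟨ sym (ℤ.*-assoc (f 0) _ _) ⟩
  f 0 *ℤ prodℤ (applyUpTo (f ∘ suc) n) *ℤ f (suc n)    ∎

map-oneTo : ∀ {A : Set} (f : ℕ → A) n → map f (oneTo n) ≡ applyUpTo (f ∘ suc) n
map-oneTo f n = trans (cong (map f) (map-applyUpTo id suc n)) (map-applyUpTo suc f n)

map-range : ∀ {A : Set} (f : ℕ → A) a b → map f (range a b) ≡ applyUpTo (λ i → f (a + i)) (suc b ∸ a)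
map-range f a b =
  trans (cong (map f) (map-applyUpTo id (λ i → a + i) _)) (map-applyUpTo (λ i → a + i) f _)

μraw-below-level : ∀ s t u {v} → v < t → μraw s t u v ≡ + 0
μraw-below-level s t u {zero} _ = refl
μraw-below-level s t u {suc v} v<t
  rewrite ≮⇒<ᵇ-false (<-asym v<t) | ≢⇒≡ᵇ-false (>⇒≢ v<t) = refl

μraw-same-level : ∀ s t u → 1 ≤ t → μraw s t u t ≡ δ s u
μraw-same-level s (suc t) u _ rewrite ≮⇒<ᵇ-false (<-irrefl {t} refl) | ≡ᵇ-refl t with s ≡ᵇ u
... | true = refl
... | false = refl

μraw-above-level : ∀ s t u {v} → t ≤ v → μraw s t u (suc v) ≡ - below s t v
μraw-above-level s t u t≤v rewrite <⇒<ᵇ-true (s≤s t≤v) | ≢⇒≡ᵇ-false (<⇒≢ (s≤s t≤v)) = refl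

if-leqᵇ-μraw : ∀ s t u v →
  (if leqᵇ s t u (suc v) then μraw s t u (suc v) else + 0) ≡ μraw s t u (suc v)
if-leqᵇ-μraw s t u v with leqᵇ s t u (suc v)
... | true = refl
... | false = refl

below-suc : ∀ s t w →
  below s t (suc w) ≡ below s t w +ℤ sumℤ (applyUpTo (λ j → μraw s t (suc j) (suc w)) (F (suc w)))
below-suc s t w = cong (below s t w +ℤ_) (cong sumℤ (begin
  map (λ j → if leqᵇ s t j (suc w) then μraw s t j (suc w) else + 0) (oneTo (F (suc w)))
    ≡⟨ map-cong (λ j → if-leqᵇ-μraw s t j w) (oneTo (F (suc w))) ⟩
  map (λ j → μraw s t j (suc w)) (oneTo (F (suc w)))
    ≡⟨ map-oneTo (λ j → μraw s t j (suc w)) (F (suc w)) ⟩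
  applyUpTo (λ j → μraw s t (suc j) (suc w)) (F (suc w)) ∎))

below-under-level : ∀ s t {w} → w < t → below s t w ≡ + 0
below-under-level s t {zero} _ = refl
below-under-level s t {suc w} w<t = trans (below-suc s t w) (cong₂ _+ℤ_
  (below-under-level s t (<-trans (n<1+n w) w<t))
  (sum-applyUpTo-zero _ (F (suc w)) (λ j → μraw-below-level s t (suc j) w<t)))

below-at-level : ∀ s t → 1 ≤ s → s ≤ F t → below s t t ≡ + 1
below-at-level (suc s) (suc t) _ s<Ft = trans (below-suc (suc s) (suc t) t) (cong₂ _+ℤ_
  (below-under-level (suc s) (suc t) (n<1+n t))
  (trans (sum-applyUpTo-single _ s<Ft off-diagonal)
         (trans (μraw-same-level (suc s) (suc t) (suc s) (s≤s z≤n)) (δ-refl (suc s)))))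
  where
  off-diagonal : ∀ j → j ≢ s → μraw (suc s) (suc t) (suc j) (suc t) ≡ + 0
  off-diagonal j j≢s = trans (μraw-same-level (suc s) (suc t) (suc j) (s≤s z≤n)) (δ-≢ (≢-sym j≢s))

below-step : ∀ s t {v} → t ≤ v → below s t (suc v) ≡ below s t v *ℤ (+ 1 -ℤ + F (suc v))
below-step s t {v} t≤v = begin
  below s t (suc v)
    ≡⟨ below-suc s t v ⟩
  below s t v +ℤ sumℤ (applyUpTo (λ j → μraw s t (suc j) (suc v)) (F (suc v)))
    ≡⟨ cong (below s t v +ℤ_)
            (sum-applyUpTo-const _ (F (suc v)) (λ j → μraw-above-level s t (suc j) t≤v)) ⟩
  below s t v +ℤ + F (suc v) *ℤ - below s t v
    ≡⟨ factor (below s t v) (+ F (suc v)) ⟩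
  below s t v *ℤ (+ 1 -ℤ + F (suc v))
    ∎
  where
  factor : ∀ b n → b +ℤ n *ℤ - b ≡ b *ℤ (+ 1 -ℤ n)
  factor = solve-∀

fibProduct : ℕ → ℕ → ℤ
fibProduct t k = prodℤ (applyUpTo (λ i → + F (suc (t + i)) -ℤ + 1) k)

below-closed-form : ∀ s t k → 1 ≤ s → s ≤ F t → below s t (t + k) ≡ (- + 1) ^ℤ k *ℤ fibProduct t k
below-closed-form s t zero 1≤s s≤Ft rewrite +-identityʳ t = below-at-level s t 1≤s s≤Ft
below-closed-form s t (suc k) 1≤s s≤Ft = begin
  below s t (t + suc k)                          ≡⟨ cong (below s t) (+-suc t k) ⟩
  below s t (suc (t + k))                        ≡⟨ below-step s t (m≤m+n t k) ⟩
  below s t (t + k) *ℤ (+ 1 -ℤ X)                ≡⟨ cong (_*ℤ (+ 1 -ℤ X)) (below-closed-form s t k 1≤s s≤Ft) ⟩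
  (- + 1) ^ℤ k *ℤ fibProduct t k *ℤ (+ 1 -ℤ X)  ≡⟨ regroup ((- + 1) ^ℤ k) (fibProduct t k) X ⟩
  (- + 1) ^ℤ suc k *ℤ (fibProduct t k *ℤ (X -ℤ + 1))
    ≡⟨ cong ((- + 1) ^ℤ suc k *ℤ_) (sym (prod-applyUpTo-suc _ k)) ⟩
  (- + 1) ^ℤ suc k *ℤ fibProduct t (suc k)      ∎
  where
  X = + F (suc (t + k))
  regroup : ∀ p q x → p *ℤ q *ℤ (+ 1 -ℤ x) ≡ (- + 1) *ℤ p *ℤ (q *ℤ (x -ℤ + 1))
  regroup = solve-∀

formulaTerm : ℕ → ℕ → ℕ → ℤ
formulaTerm t v k =
  δ (t + k) v *ℤ (- + 1) ^ℤ k *ℤ prodℤ (map (λ i → + F i -ℤ + 1) (range (suc t) (v ∸ 1)))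

formulaSum : ℕ → ℕ → ℤ
formulaSum t v = sumℤ (map (formulaTerm t v) (range 2 v))

formula-cong : ∀ s t u v {a b c} → δ t v ≡ a → δ (suc t) v ≡ b → formulaSum t v ≡ c →
               formula s t u v ≡ a *ℤ δ s u -ℤ b +ℤ c
formula-cong s t u v p q r = cong₂ _+ℤ_ (cong₂ _-ℤ_ (cong (_*ℤ δ s u) p) q) r

formulaSum-vanishes : ∀ t v → v < 2 + t → formulaSum t v ≡ + 0
formulaSum-vanishes t v v<2+t = trans (cong sumℤ (map-range (formulaTerm t v) 2 v))
  (sum-applyUpTo-zero (λ i → formulaTerm t v (2 + i)) (suc v ∸ 2) λ i →
    cong (λ d → d *ℤ (- + 1) ^ℤ (2 + i) *ℤ _) (δ-≢ (>⇒≢ (<-≤-trans v<2+t (2+t≤t+[2+i] i)))))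
  where
  2+t≤t+[2+i] : ∀ i → 2 + t ≤ t + (2 + i)
  2+t≤t+[2+i] i = ≤-trans (≤-reflexive (+-comm 2 t)) (+-monoʳ-≤ t (m≤m+n 2 i))

prod-range-fibProduct : ∀ t k →
  prodℤ (map (λ i → + F i -ℤ + 1) (range (suc t) (t + k))) ≡ fibProduct t k
prod-range-fibProduct t k = trans (cong prodℤ (map-range _ (suc t) (t + k)))
  (cong (λ n → prodℤ (applyUpTo (λ i → + F (suc (t + i)) -ℤ + 1) n)) (m+n∸m≡n t k))

formulaSum-peak : ∀ t m → formulaSum t (suc (t + suc m)) ≡ (- + 1) ^ℤ (2 + m) *ℤ fibProduct t (suc m)
formulaSum-peak t m = begin
  formulaSum t v                                          ≡⟨ cong sumℤ (map-range (formulaTerm t v) 2 v) ⟩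
  sumℤ (applyUpTo term (t + suc m))                       ≡⟨ sum-applyUpTo-single term m<len off-peak ⟩
  δ (t + (2 + m)) v *ℤ (- + 1) ^ℤ (2 + m) *ℤ P
    ≡⟨ cong (λ d → d *ℤ (- + 1) ^ℤ (2 + m) *ℤ P) δ-at-peak ⟩
  + 1 *ℤ (- + 1) ^ℤ (2 + m) *ℤ P
    ≡⟨ cong₂ _*ℤ_ (ℤ.*-identityˡ ((- + 1) ^ℤ (2 + m))) (prod-range-fibProduct t (suc m)) ⟩
  (- + 1) ^ℤ (2 + m) *ℤ fibProduct t (suc m)              ∎
  where
  v = suc (t + suc m)
  P = prodℤ (map (λ i → + F i -ℤ + 1) (range (suc t) (t + suc m)))
  term : ℕ → ℤ
  term i = δ (t + (2 + i)) v *ℤ (- + 1) ^ℤ (2 + i) *ℤ P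
  m<len : m < t + suc m
  m<len = <-≤-trans (n<1+n m) (m≤n+m (suc m) t)
  off-peak : ∀ i → i ≢ m → term i ≡ + 0
  off-peak i i≢m = cong (λ d → d *ℤ _ *ℤ P) (δ-≢ λ e →
    i≢m (cong (_∸ 2) (+-cancelˡ-≡ t (2 + i) (2 + m) (trans e (sym (+-suc t (suc m)))))))
  δ-at-peak : δ (t + (2 + m)) v ≡ + 1
  δ-at-peak = trans (cong (λ n → δ n v) (+-suc t (suc m))) (δ-refl v)

formula-below-level : ∀ s t u {v} → v < t → formula s t u v ≡ + 0
formula-below-level s t u {v} v<t = formula-cong s t u v
  (δ-≢ (>⇒≢ v<t))
  (δ-≢ (>⇒≢ (<-trans v<t (n<1+n t))))
  (formulaSum-vanishes t v (≤-trans v<t (m≤n+m t 2)))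

formula-same-level : ∀ s t u → formula s t u t ≡ δ s u
formula-same-level s t u = trans
  (formula-cong s t u t (δ-refl t) (δ-≢ (>⇒≢ (n<1+n t))) (formulaSum-vanishes t t (m≤n+m (suc t) 1)))
  (unit (δ s u))
  where
  unit : ∀ x → + 1 *ℤ x -ℤ + 0 +ℤ + 0 ≡ x
  unit = solve-∀

formula-above-level : ∀ s t u k → formula s t u (suc (t + k)) ≡ - ((- + 1) ^ℤ k *ℤ fibProduct t k)
formula-above-level s t u zero = formula-cong s t u (suc (t + 0))
  (δ-≢ (<⇒≢ (s≤s (m≤m+n t 0))))
  (trans (cong (δ (suc t)) (cong suc (+-identityʳ t))) (δ-refl (suc t)))
  (formulaSum-vanishes t (suc (t + 0)) (s≤s (s≤s (≤-reflexive (+-identityʳ t)))))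
formula-above-level s t u (suc m) = trans
  (formula-cong s t u (suc (t + suc m)) (δ-≢ (<⇒≢ (s≤s (m≤m+n t (suc m)))))
                (δ-≢ (<⇒≢ (s≤s (m<m+n t (s≤s z≤n)))))
                (formulaSum-peak t m))
  (sign (δ s u) ((- + 1) ^ℤ suc m) (fibProduct t (suc m)))
  where
  sign : ∀ d p q → + 0 *ℤ d -ℤ + 0 +ℤ (- + 1) *ℤ p *ℤ q ≡ - (p *ℤ q)
  sign = solve-∀

mainTheorem1 : (x y : Elem) → μ x y ≡ formula (s x) (t x) (s y) (t y)
mainTheorem1 (⟨ s , t ⟩∈ (1≤t , 1≤s , s≤Ft)) (⟨ u , v ⟩∈ _) with compare v t
... | less .v k = trans (μraw-below-level s t u v<t) (sym (formula-below-level s t u v<t))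
  where
  v<t : v < t
  v<t = s≤s (m≤m+n v k)
... | equal .t = trans (μraw-same-level s t u 1≤t) (sym (formula-same-level s t u))
... | greater .t k = begin
  μraw s t u (suc (t + k))                    ≡⟨ μraw-above-level s t u (m≤m+n t k) ⟩
  - below s t (t + k)                         ≡⟨ cong -_ (below-closed-form s t k 1≤s s≤Ft) ⟩
  - ((- + 1) ^ℤ k *ℤ fibProduct t k)          ≡⟨ sym (formula-above-level s t u k) ⟩
  formula s t u (suc (t + k))                 ∎
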